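{- Let $n\ge1$ and let $\mathcal K_n$ be the matrix indexed by compositions of $n$ with $(\mathcal K_n)_{IJ}$ equal to the coefficient of $R_J$ in $P_I$. Then $\mathcal K_n$ is invertible over the field of rational functions in the $y_w$, and $$(\mathcal K_n^{ -1})_{IJ}=(-1)^{\ell(I)-1}\prod_{d\in\mathrm{Des}(\bar I^\sim)}y^d(J)\ \prod_{p=1}^{n-1}\frac{1}{y^p(J)-y_p(J)}.$$
   Context: $\{y_w\}$ are commuting indeterminates indexed by nonempty boolean words of length at most $n-1$. For a composition $I=(i_1,\dots,i_r)$ of $n$, $\ell(I)=r$ and $\mathrm{Des}(I)=\{i_1,i_1+i_2,\dots,i_1+\dots+i_{r-1}\}$; $\bar I^\sim$ denotes the conjugate of the mirror image of $I$, the composition of $n$ with $\mathrm{Des}(\bar I^\sim)=\{1,\dots,n-1\}\setminus\mathrm{Des}(I)$. $I$ is encoded by the boolean word $u_1\cdots u_{n-1}$ with $u_k=1$ iff $k\in\mathrm{Des}(I)$; $y_k(I)=y_{u_1\cdots u_k}$ and $y^k(I)=y_{u_1\cdots u_{k-1}(1-u_k)}$. Identifying $\mathbf{Sym}_n$ with the Grassmann algebra on $\eta_1,\dots,\eta_{n-1}$ via $R_I\leftrightarrow\eta_{d_1}\cdots\eta_{d_k}$ ($R_I$ ribbon basis, $\mathrm{Des}(I)=\{d_1<\dots<d_k\}$), $P_I=(1+y_1(I)\eta_1)(1+y_2(I)\eta_2)\cdots(1+y_{n-1}(I)\eta_{n-1})$; equivalently $P_I=\sum_{J\vDash n}\bigl(\prod_{d\in\mathrm{Des}(J)}y_d(I)\bigr)R_J$.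 -}

module Defs where

open import Level using (Level)
open import Data.Nat using (ℕ; zero; suc)
open import Data.Bool using (Bool; true; false; not; if_then_else_; _∧_)
open import Data.Fin using (Fin; toℕ)
import Data.Fin as F
open import Data.Vec using (Vec; []; _∷_; lookup; toList)
open import Data.List using (List; take; _++_; [_])
open import Algebra.Bundles using (CommutativeRing)

-- A composition I of n = suc m is encoded by its boolean word u₁⋯u_m
-- (u_k = true iff k ∈ Des(I)); position k (1-based) is index k-1 : Fin m.
Comp : ℕ → Set
Comp m = Vec Bool m

-- number of descents; ℓ(I) = 1 + nDes I
nDes : ∀ {m} → Comp m → ℕ
nDes [] = zero
nDes (true ∷ u) = suc (nDes u)
nDes (false ∷ u) = nDes u

eqC : ∀ {m} → Comp m → Comp m → Bool
eqC [] [] = true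
eqC (a ∷ u) (b ∷ v) = (if a then b else not b) ∧ eqC u v

module RingDefs {c ℓ : Level} (R : CommutativeRing c ℓ) where
  open CommutativeRing R

  sumC : (m : ℕ) → (Comp m → Carrier) → Carrier
  sumC zero f = f []
  sumC (suc m) f = sumC m (λ v → f (false ∷ v)) + sumC m (λ v → f (true ∷ v))

  prodF : (m : ℕ) → (Fin m → Carrier) → Carrier
  prodF zero f = 1#
  prodF (suc m) f = f F.zero * prodF m (λ k → f (F.suc k))

  sgn : ℕ → Carrier
  sgn zero = 1#
  sgn (suc k) = - sgn k

  -- the indeterminates: y : (boolean words) → R ; only nonempty words
  -- of length ≤ m are ever used.
  module WithY {m : ℕ} (y : List Bool → Carrier) where
    -- y_k(I) = y_{u₁⋯u_k}, k = toℕ p + 1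
    yLow : Comp m → Fin m → Carrier
    yLow I p = y (take (suc (toℕ p)) (toList I))

    -- y^k(I) = y_{u₁⋯u_{k-1}(1-u_k)}
    yUp : Comp m → Fin m → Carrier
    yUp I p = y (take (toℕ p) (toList I) ++ [ not (lookup I p) ])

    -- (K_n)_{IJ} = coefficient of R_J in P_I = ∏_{d ∈ Des(J)} y_d(I)
    K : Comp m → Comp m → Carrier
    K I J = prodF m (λ p → if lookup J p then yLow I p else 1#)

    -- claimed inverse, given inverses inv J p of y^p(J) - y_p(J):
    -- (-1)^{ℓ(I)-1} ∏_{d ∈ Des(Ī~)} y^d(J) ∏_p 1/(y^p(J) - y_p(J)),
    -- where Des(Ī~) = {1..n-1} \ Des(I).
    Kinv : (Comp m → Fin m → Carrier) → Comp m → Comp m → Carrier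
    Kinv inv I J =
      sgn (nDes I)
        * (prodF m (λ d → if lookup I d then 1# else yUp J d)
        * prodF m (λ p → inv J p))

    mul : (Comp m → Comp m → Carrier) → (Comp m → Comp m → Carrier)
        → Comp m → Comp m → Carrier
    mul A B I J = sumC m (λ L → A I L * B L J)

    idM : Comp m → Comp m → Carrier
    idM I J = if eqC I J then 1# else 0#

-- Splitting off the first letter of the boolean words exhibits K_{n+1} as a
-- twisted Kronecker product: its (a u, b v) entry is the (a, b) entry of K₂
-- times the (u, v) entry of the K_n built from the indeterminates y_{a w}.
-- Likewise the (a u, b v) entry of Kinv_{n+1} is the (a, b) entry of Kinv₂
-- times that of the Kinv_n built from the y_{b w}.  In K_{n+1} Kinv_{n+1} a block
-- with a ≠ a′ is killed by its 2 × 2 factor, and in Kinv_{n+1} K_{n+1} both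
-- factors of a block come from the letter summed over, so both products reduce
-- to n = 2 and induction.  The inverses of y^1 - y_1 entering the 2 × 2 factors
-- are determined by the hypothesis, hence the same in every block, and opposite
-- for the two letters.
module Submission where

open import Defs
open import Data.Nat using (ℕ; zero; suc)
open import Data.Bool using (Bool; true; false; not; if_then_else_)
open import Data.Fin using (Fin)
import Data.Fin as F
open import Data.Vec using ([]; _∷_)
open import Data.List using (List; [_]) renaming (_∷_ to _∷ₗ_)
open import Data.Product using (_×_; _,_)
open import Relation.Binary.PropositionalEquality as ≡ using (_≡_)
open import Algebra.Bundles using (CommutativeRing)

module _ {r ℓ} (R : CommutativeRing r ℓ) where
  open CommutativeRing R
  open RingDefs R
  open import Algebra.Properties.Ring ring using (-1*x≈-x; -‿distribˡ-*; -‿distribʳ-*; -‿involutive)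
  open import Algebra.Properties.AbelianGroup +-abelianGroup using (⁻¹-anti-homo‿-)
  open import Algebra.Properties.CommutativeSemigroup *-commutativeSemigroup using (interchange)
  open import Algebra.Solver.Ring.NaturalCoefficients.Default commutativeSemiring
  open import Relation.Binary.Reasoning.Setoid setoid

  inverse-unique : ∀ x {a b} → x * a ≈ 1# → x * b ≈ 1# → a ≈ b
  inverse-unique x {a} {b} xa≈1 xb≈1 = begin
    a             ≈⟨ *-identityʳ a ⟨
    a * 1#        ≈⟨ *-congˡ xb≈1 ⟨
    a * (x * b)   ≈⟨ solve 3 (λ a x b → a :* (x :* b) := (x :* a) :* b) refl a x b ⟩
    (x * a) * b   ≈⟨ *-congʳ xa≈1 ⟩
    1# * b        ≈⟨ *-identityˡ b ⟩
    b             ∎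

  inverse-of-difference-antisym : ∀ p q {c c′} →
    (p - q) * c ≈ 1# → (q - p) * c′ ≈ 1# → c′ ≈ - c
  inverse-of-difference-antisym p q {c} {c′} hc hc′ = inverse-unique (q - p) hc′ (begin
    (q - p) * (- c)      ≈⟨ -‿distribʳ-* (q - p) c ⟨
    - ((q - p) * c)      ≈⟨ -‿distribˡ-* (q - p) c ⟩
    (- (q - p)) * c      ≈⟨ *-congʳ (⁻¹-anti-homo‿- q p) ⟩
    (p - q) * c          ≈⟨ hc ⟩
    1#                   ∎)

  difference-self-* : ∀ x z → (x - x) * z ≈ 0#
  difference-self-* x z = trans (*-congʳ (-‿inverseʳ x)) (zeroˡ z)

  sumC-cong : ∀ m {f g : Comp m → Carrier} → (∀ v → f v ≈ g v) → sumC m f ≈ sumC m g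
  sumC-cong zero    f≈g = f≈g []
  sumC-cong (suc m) f≈g =
    +-cong (sumC-cong m (λ v → f≈g (false ∷ v))) (sumC-cong m (λ v → f≈g (true ∷ v)))

  sumC-*ˡ : ∀ m x (f : Comp m → Carrier) → sumC m (λ v → x * f v) ≈ x * sumC m f
  sumC-*ˡ zero    x f = refl
  sumC-*ˡ (suc m) x f = trans (+-cong (sumC-*ˡ m x _) (sumC-*ˡ m x _)) (sym (distribˡ x _ _))

  sumB : (Bool → Carrier) → Carrier
  sumB f = f false + f true

  sumB-*ʳ : ∀ (f : Bool → Carrier) x → sumB (λ b → f b * x) ≈ sumB f * x
  sumB-*ʳ f x = sym (distribʳ x (f false) (f true))

  sumC-∷-* : ∀ m (f g : Comp (suc m) → Carrier) {α β : Bool → Carrier}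
    {f′ g′ : Bool → Comp m → Carrier} →
    (∀ b v → f (b ∷ v) ≈ α b * f′ b v) → (∀ b v → g (b ∷ v) ≈ β b * g′ b v) →
    sumC (suc m) (λ L → f L * g L)
      ≈ sumB (λ b → (α b * β b) * sumC m (λ v → f′ b v * g′ b v))
  sumC-∷-* m f g {α} {β} {f′} {g′} f≈ g≈ = +-cong (block false) (block true)
    where
    block : ∀ b → sumC m (λ v → f (b ∷ v) * g (b ∷ v))
                ≈ (α b * β b) * sumC m (λ v → f′ b v * g′ b v)
    block b = trans
      (sumC-cong m (λ v → trans (*-cong (f≈ b v) (g≈ b v)) (interchange _ _ _ _)))
      (sumC-*ˡ m (α b * β b) _)

  prefixed : (List Bool → Carrier) → Bool → List Bool → Carrier
  prefixed y b w = y (b ∷ₗ w)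

  prefixedInv : ∀ {m} → (Comp (suc m) → Fin (suc m) → Carrier) → Bool
              → Comp m → Fin m → Carrier
  prefixedInv inv b v q = inv (b ∷ v) (F.suc q)

  GapInverse : ∀ m → (List Bool → Carrier) → (Comp m → Fin m → Carrier) → Set ℓ
  GapInverse m y inv =
    ∀ J p → (WithY.yUp {m} y J p - WithY.yLow {m} y J p) * inv J p ≈ 1#

  -- K and Kinv for n = 2, where the inverses of y^1(b) - y_1(b) are given by c b.
  K₂ : (List Bool → Carrier) → Bool → Bool → Carrier
  K₂ y a b = if b then y [ a ] else 1#

  Kinv₂ : (List Bool → Carrier) → (Bool → Carrier) → Bool → Bool → Carrier
  Kinv₂ y c a b = sgn (nDes (a ∷ [])) * ((if a then 1# else y [ not b ]) * c b)

  id₂ : Bool → Bool → Carrier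
  id₂ a b = if (if a then b else not b) then 1# else 0#

  K-∷ : ∀ m y a u b v →
    WithY.K {suc m} y (a ∷ u) (b ∷ v) ≈ K₂ y a b * WithY.K {m} (prefixed y a) u v
  K-∷ m y a u b v = refl

  sgn-nDes-∷ : ∀ {m} a (u : Comp m) → sgn (nDes (a ∷ u)) ≈ sgn (nDes (a ∷ [])) * sgn (nDes u)
  sgn-nDes-∷ false u = sym (*-identityˡ _)
  sgn-nDes-∷ true  u = sym (-1*x≈-x _)

  Kinv-∷ : ∀ m y inv (c : Bool → Carrier) a u b v → c b ≈ inv (b ∷ v) F.zero →
    WithY.Kinv {suc m} y inv (a ∷ u) (b ∷ v)
      ≈ Kinv₂ y c a b * WithY.Kinv {m} (prefixed y b) (prefixedInv inv b) u v
  Kinv-∷ m y inv c a u b v cb≈ =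
    trans (*-cong (sgn-nDes-∷ a u) (*-congˡ (*-congʳ (sym cb≈))))
          (solve 6 (λ σ s e P₁ x P₂ → (σ :* s) :* ((e :* P₁) :* (x :* P₂))
                                      := (σ :* (e :* x)) :* (s :* (P₁ :* P₂)))
                   refl _ _ _ _ _ _)

  id₂-* : ∀ {m} y a b {x} (u v : Comp m) → (a ≡ b → x ≈ WithY.idM {m} y u v) →
    id₂ a b * x ≈ WithY.idM {suc m} y (a ∷ u) (b ∷ v)
  id₂-* y false false u v x≈ = trans (*-identityˡ _) (x≈ ≡.refl)
  id₂-* y true  true  u v x≈ = trans (*-identityˡ _) (x≈ ≡.refl)
  id₂-* y false true  u v x≈ = zeroˡ _
  id₂-* y true  false u v x≈ = zeroˡ _

  module _ (y : List Bool → Carrier) (c : Bool → Carrier) where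

    K₂-Kinv₂-entry : ∀ a a′ →
      sumB (λ b → K₂ y a b * Kinv₂ y c b a′) ≈ (y [ not a′ ] - y [ a ]) * c a′
    K₂-Kinv₂-entry a a′ = begin
      1# * (1# * (Y * x)) + ya * (- 1# * (1# * x))
        ≈⟨ solve 4 (λ Y ya x m → con 1 :* (con 1 :* (Y :* x)) :+ ya :* (m :* (con 1 :* x))
                                 := Y :* x :+ (m :* ya) :* x) refl Y ya x (- 1#) ⟩
      Y * x + (- 1# * ya) * x   ≈⟨ +-congˡ (*-congʳ (-1*x≈-x ya)) ⟩
      Y * x + (- ya) * x        ≈⟨ distribʳ x Y (- ya) ⟨
      (Y - ya) * x              ∎
      where
      Y ya x : Carrier
      Y = y [ not a′ ]
      ya = y [ a ]
      x = c a′

    module _ (gap : ∀ b → (y [ not b ] - y [ b ]) * c b ≈ 1#) where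

      K₂-Kinv₂ : ∀ a a′ → sumB (λ b → K₂ y a b * Kinv₂ y c b a′) ≈ id₂ a a′
      K₂-Kinv₂ false false = trans (K₂-Kinv₂-entry false false) (gap false)
      K₂-Kinv₂ true  true  = trans (K₂-Kinv₂-entry true true) (gap true)
      K₂-Kinv₂ false true  = trans (K₂-Kinv₂-entry false true) (difference-self-* _ _)
      K₂-Kinv₂ true  false = trans (K₂-Kinv₂-entry true false) (difference-self-* _ _)

      private
        y₀ y₁ c₀ : Carrier
        y₀ = y [ false ]
        y₁ = y [ true ]
        c₀ = c false

        collect-c₀ : ∀ x z → x * c₀ + z * c true ≈ (x - z) * c₀
        collect-c₀ x z = begin
          x * c₀ + z * c true
            ≈⟨ +-congˡ (*-congˡ (inverse-of-difference-antisym y₁ y₀ (gap false) (gap true))) ⟩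
          x * c₀ + z * (- c₀)   ≈⟨ +-congˡ (-‿distribʳ-* z c₀) ⟨
          x * c₀ + - (z * c₀)   ≈⟨ +-congˡ (-‿distribˡ-* z c₀) ⟩
          x * c₀ + (- z) * c₀   ≈⟨ distribʳ c₀ x (- z) ⟨
          (x - z) * c₀          ∎

      Kinv₂-K₂ : ∀ a a′ → sumB (λ b → Kinv₂ y c a b * K₂ y b a′) ≈ id₂ a a′
      Kinv₂-K₂ false false = begin
        (1# * (y₁ * c₀)) * 1# + (1# * (y₀ * c true)) * 1#
          ≈⟨ solve 4 (λ y₀ y₁ c₀ c₁ →
                 (con 1 :* (y₁ :* c₀)) :* con 1 :+ (con 1 :* (y₀ :* c₁)) :* con 1
                 := y₁ :* c₀ :+ y₀ :* c₁) refl y₀ y₁ c₀ (c true) ⟩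
        y₁ * c₀ + y₀ * c true   ≈⟨ collect-c₀ y₁ y₀ ⟩
        (y₁ - y₀) * c₀          ≈⟨ gap false ⟩
        1#                      ∎
      Kinv₂-K₂ false true = begin
        (1# * (y₁ * c₀)) * y₀ + (1# * (y₀ * c true)) * y₁
          ≈⟨ solve 4 (λ y₀ y₁ c₀ c₁ →
                 (con 1 :* (y₁ :* c₀)) :* y₀ :+ (con 1 :* (y₀ :* c₁)) :* y₁
                 := (y₀ :* y₁) :* c₀ :+ (y₀ :* y₁) :* c₁) refl y₀ y₁ c₀ (c true) ⟩
        (y₀ * y₁) * c₀ + (y₀ * y₁) * c true   ≈⟨ collect-c₀ _ _ ⟩
        (y₀ * y₁ - y₀ * y₁) * c₀              ≈⟨ difference-self-* _ _ ⟩
        0#                                    ∎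
      Kinv₂-K₂ true false = begin
        (- 1# * (1# * c₀)) * 1# + (- 1# * (1# * c true)) * 1#
          ≈⟨ solve 3 (λ m c₀ c₁ →
                 (m :* (con 1 :* c₀)) :* con 1 :+ (m :* (con 1 :* c₁)) :* con 1
                 := m :* c₀ :+ m :* c₁) refl (- 1#) c₀ (c true) ⟩
        - 1# * c₀ + - 1# * c true   ≈⟨ collect-c₀ _ _ ⟩
        (- 1# - - 1#) * c₀          ≈⟨ difference-self-* _ _ ⟩
        0#                          ∎
      Kinv₂-K₂ true true = begin
        (- 1# * (1# * c₀)) * y₀ + (- 1# * (1# * c true)) * y₁
          ≈⟨ solve 5 (λ m y₀ y₁ c₀ c₁ →
                 (m :* (con 1 :* c₀)) :* y₀ :+ (m :* (con 1 :* c₁)) :* y₁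
                 := (m :* y₀) :* c₀ :+ (m :* y₁) :* c₁) refl (- 1#) y₀ y₁ c₀ (c true) ⟩
        (- 1# * y₀) * c₀ + (- 1# * y₁) * c true   ≈⟨ collect-c₀ _ _ ⟩
        (- 1# * y₀ - - 1# * y₁) * c₀              ≈⟨ *-congʳ minus-one-difference ⟩
        (y₁ - y₀) * c₀                            ≈⟨ gap false ⟩
        1#                                        ∎
        where
        minus-one-difference : - 1# * y₀ - - 1# * y₁ ≈ y₁ - y₀
        minus-one-difference = begin
          - 1# * y₀ - - 1# * y₁   ≈⟨ +-cong (-1*x≈-x y₀) (-‿cong (-1*x≈-x y₁)) ⟩
          - y₀ - - y₁             ≈⟨ +-congˡ (-‿involutive y₁) ⟩
          - y₀ + y₁               ≈⟨ +-comm (- y₀) y₁ ⟩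
          y₁ - y₀                 ∎

  K-Kinv : ∀ m y inv → GapInverse m y inv → ∀ I J →
    WithY.mul {m} y (WithY.K {m} y) (WithY.Kinv {m} y inv) I J ≈ WithY.idM {m} y I J
  K-Kinv zero y inv gap [] [] =
    solve 0 (con 1 :* (con 1 :* (con 1 :* con 1)) := con 1) refl
  K-Kinv (suc m) y inv gap (a ∷ u) (a′ ∷ u′) = begin
    WithY.mul y (WithY.K y) (WithY.Kinv y inv) (a ∷ u) (a′ ∷ u′)
      ≈⟨ sumC-∷-* m (WithY.K y (a ∷ u)) (λ L → WithY.Kinv y inv L (a′ ∷ u′))
                   (K-∷ m y a u) (λ b v → Kinv-∷ m y inv c b v a′ u′ refl) ⟩
    sumB (λ b → (K₂ y a b * Kinv₂ y c b a′) * M)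
      ≈⟨ sumB-*ʳ (λ b → K₂ y a b * Kinv₂ y c b a′) M ⟩
    sumB (λ b → K₂ y a b * Kinv₂ y c b a′) * M
      ≈⟨ *-congʳ (K₂-Kinv₂ y c (λ b → gap (b ∷ u′) F.zero) a a′) ⟩
    id₂ a a′ * M
      ≈⟨ id₂-* y a a′ u u′ (λ { ≡.refl → K-Kinv m (prefixed y a) (prefixedInv inv a)
                                         (λ J p → gap (a ∷ J) (F.suc p)) u u′ }) ⟩
    WithY.idM y (a ∷ u) (a′ ∷ u′) ∎
    where
    c : Bool → Carrier
    c b = inv (b ∷ u′) F.zero
    M : Carrier
    M = WithY.mul {m} y (WithY.K (prefixed y a))
                        (WithY.Kinv (prefixed y a′) (prefixedInv inv a′)) u u′

  Kinv-K : ∀ m y inv → GapInverse m y inv → ∀ I J →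
    WithY.mul {m} y (WithY.Kinv {m} y inv) (WithY.K {m} y) I J ≈ WithY.idM {m} y I J
  Kinv-K zero y inv gap [] [] =
    solve 0 ((con 1 :* (con 1 :* con 1)) :* con 1 := con 1) refl
  Kinv-K (suc m) y inv gap (a ∷ u) (a′ ∷ u′) = begin
    WithY.mul y (WithY.Kinv y inv) (WithY.K y) (a ∷ u) (a′ ∷ u′)
      ≈⟨ sumC-∷-* m (WithY.Kinv y inv (a ∷ u)) (λ L → WithY.K y L (a′ ∷ u′))
                   (λ b v → Kinv-∷ m y inv c a u b v (c-independent b v))
                   (λ b v → K-∷ m y b v a′ u′) ⟩
    sumB (λ b → (Kinv₂ y c a b * K₂ y b a′) * M b)
      ≈⟨ +-cong (*-congˡ (IH false)) (*-congˡ (IH true)) ⟩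
    sumB (λ b → (Kinv₂ y c a b * K₂ y b a′) * WithY.idM {m} y u u′)
      ≈⟨ sumB-*ʳ (λ b → Kinv₂ y c a b * K₂ y b a′) _ ⟩
    sumB (λ b → Kinv₂ y c a b * K₂ y b a′) * WithY.idM {m} y u u′
      ≈⟨ *-congʳ (Kinv₂-K₂ y c (λ b → gap (b ∷ u) F.zero) a a′) ⟩
    id₂ a a′ * WithY.idM {m} y u u′
      ≈⟨ id₂-* y a a′ u u′ (λ _ → refl) ⟩
    WithY.idM y (a ∷ u) (a′ ∷ u′) ∎
    where
    c : Bool → Carrier
    c b = inv (b ∷ u) F.zero
    c-independent : ∀ b v → c b ≈ inv (b ∷ v) F.zero
    c-independent b v = inverse-unique _ (gap (b ∷ u) F.zero) (gap (b ∷ v) F.zero)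
    M : Bool → Carrier
    M b = WithY.mul {m} y (WithY.Kinv (prefixed y b) (prefixedInv inv b))
                          (WithY.K (prefixed y b)) u u′
    IH : ∀ b → M b ≈ WithY.idM {m} y u u′
    IH b = Kinv-K m (prefixed y b) (prefixedInv inv b) (λ J p → gap (b ∷ J) (F.suc p)) u u′

mainTheorem4 : ∀ {c ℓ} (R : CommutativeRing c ℓ) (m : ℕ)
    (y : List Bool → CommutativeRing.Carrier R)
    (inv : Comp m → Fin m → CommutativeRing.Carrier R)
    → let open CommutativeRing R
          open RingDefs R
          open WithY {m} y
      in (∀ J p → (yUp J p - yLow J p) * inv J p ≈ 1#)
      → (∀ I J → mul K (Kinv inv) I J ≈ idM I J)
        × (∀ I J → mul (Kinv inv) K I J ≈ idM I J)
mainTheorem4 R m y inv gap = K-Kinv R m y inv gap , Kinv-K R m y inv gap
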